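{- The map $p_3:\mathrm{Frieze}(3)\to\mathrm{YFrieze}(3)$ is surjective.
   Context: A (Coxeter) frieze pattern is an array of staggered infinite rows of numbers satisfying the unimodular rule $WE-NS=1$ for every diamond with $N$ above, $S$ below, $W$ and $E$ left and right; its initial row (row $0$) consists of $0$'s and row $1$ consists of $1$'s. It is closed of width $n$ if row $n+2$ consists of $1$'s and row $n+3$ of $0$'s, with exactly $n$ rows strictly between the two rows of $1$'s; it is arithmetic if all rows other than the rows of $0$'s consist of positive integers. $\mathrm{Frieze}(n)$ is the set of arithmetic frieze patterns of width $n$. A Y-frieze pattern of width $n$ is an array of rational numbers $y_{i,j}$, $i=0,\dots,n+1$, $j\in\mathbb{Z}$, in staggered rows (entry $y_{i,j}$ at horizontal position $j+i/2$), with rows $0$ and $n+1$ entirely $0$, no row in between entirely $0$, and $y_{i,j}y_{i,j+1}=(1+y_{i-1,j+1})(1+y_{i+1,j})$ for $1\le i\le n$; it is arithmetic if all entries in rows $1,\dots,n$ are positive integers. $\mathrm{YFrieze}(n)$ is the set of arithmetic Y-frieze patterns of width $n$. A Y-frieze pattern is determined by its first row via the diamond rule. The map $p_n:\mathrm{Frieze}(n)\to\mathrm{YFrieze}(n)$ (known to be well defined, by a result of de St. Germain) sends a frieze $F$ to the Y-frieze pattern whose first row equals the row of $F$ two rows below the row of $1$'s; equivalently, if $(m_j)_{j\in\mathbb{Z}}$ are the consecutive entries of the row of $F$ directly below the row of $1$'s, the first row of $p_n(F)$ is $(m_jm_{j+1}-1)_{j\in\mathbb{Z}}$. -}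

module Defs where

open import Data.Nat using (ℕ; zero; suc) renaming (_+_ to _+ℕ_; _≤_ to _≤ℕ_; _<_ to _<ℕ_)
open import Data.Integer using (ℤ; +_; 0ℤ; 1ℤ; _+_; _-_; _*_; _<_)
open import Data.Product using (∃; Σ; _×_; proj₁)
open import Relation.Binary.PropositionalEquality using (_≡_; _≢_)

-- A pattern is an array of rows indexed by ℕ (row number i) and ℤ (position j).
-- Convention: entry (i , j) sits at horizontal position j + i/2, so the diamond
-- with West = (i , j) has East = (i , j+1), North = (i-1 , j+1), South = (i+1 , j).
-- Only rows 0 .. n+3 (frieze) resp. 0 .. n+1 (Y-frieze) are constrained/meaningful.
Array : Set
Array = ℕ → ℤ → ℤ

record IsArithFrieze (n : ℕ) (f : Array) : Set where
  field
    row0     : ∀ j → f 0 j ≡ 0ℤ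
    row1     : ∀ j → f 1 j ≡ 1ℤ
    rowOnes  : ∀ j → f (n +ℕ 2) j ≡ 1ℤ
    rowZeros : ∀ j → f (n +ℕ 3) j ≡ 0ℤ
    unimodular : ∀ k j → k ≤ℕ n +ℕ 1 →
      f (suc k) j * f (suc k) (j + 1ℤ) - f k (j + 1ℤ) * f (suc (suc k)) j ≡ 1ℤ
    positive : ∀ i j → 1 ≤ℕ i → i ≤ℕ n +ℕ 2 → 0ℤ < f i j

Frieze : ℕ → Set
Frieze n = Σ Array (IsArithFrieze n)

-- Arithmetic Y-frieze pattern of width n: rows 0 .. n+1.
-- (Entries of an arithmetic Y-frieze are integers, so we take integer-valued arrays.)
record IsArithYFrieze (n : ℕ) (y : Array) : Set where
  field
    row0     : ∀ j → y 0 j ≡ 0ℤ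
    rowLast  : ∀ j → y (suc n) j ≡ 0ℤ
    notZeroRow : ∀ i → 1 ≤ℕ i → i ≤ℕ n → ∃ λ j → y i j ≢ 0ℤ
    diamond : ∀ k j → k <ℕ n →
      y (suc k) j * y (suc k) (j + 1ℤ) ≡ (1ℤ + y k (j + 1ℤ)) * (1ℤ + y (suc (suc k)) j)
    positive : ∀ i j → 1 ≤ℕ i → i ≤ℕ n → 0ℤ < y i j

YFrieze : ℕ → Set
YFrieze n = Σ Array (IsArithYFrieze n)

-- First row of p_n(F): (m_j m_{j+1} - 1)_j where m_j are the entries of row 2 of F.
-- A Y-frieze is determined by its first row, so p_n(F) is the unique Y-frieze with this first row.
pFirstRow : Array → ℤ → ℤ
pFirstRow f j = f 2 j * f 2 (j + 1ℤ) - 1ℤ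

pMapsTo : {n : ℕ} → Frieze n → YFrieze n → Set
pMapsTo F Y = ∀ j → proj₁ Y 1 j ≡ pFirstRow (proj₁ F) j

module Submission where

-- Write a, b, c for rows 1, 2, 3 of a width-3 Y-frieze. The diamond rules give b_j = a_j a_{j+1} − 1,
-- c_j c_{j+1} = a_{j+1} a_{j+2} and (a_j a_{j+1} − 1)(a_{j+1} a_{j+2} − 1) = (1 + a_{j+1})(1 + c_j).
-- The last identity says c_j = a_{j+1} κ_j with κ_j = a_j a_{j+1} a_{j+2} − a_j − a_{j+2} − 1 − c_j;
-- inserted in the second one it gives κ_j κ_{j+1} = 1, so κ_j = 1 and c_j = a_{j+1}, i.e.
-- x u z = x + u + z + 2 for every three consecutive entries (x, u, z) of row 1. This equation has
-- ten positive solutions, hence row 1 is 3-periodic and of one of ten shapes. For each shape a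
-- table provides a positive 6-periodic row m with m_j m_{j+1} = a_j + 1 and m_j m_{j+3} = a_{j+2} a_j − 1,
-- and then 0, 1, m, a, m shifted by 4, 1, 0 is a frieze of width 3 that p₃ sends to the given Y-frieze.

open import Defs
open import Data.Product using (∃; _,_; _×_; proj₁; proj₂)
open import Data.List using (_∷_; [])
open import Data.Maybe using (Maybe; just; nothing; Is-just; to-witness)
import Data.Maybe.Relation.Unary.Any as Maybe
open import Data.Unit using (tt)
open import Data.Nat as ℕ using (ℕ; zero; suc; z≤n; s≤s; z<s)
import Data.Nat.Properties as ℕ
open import Data.Nat.Tactic.RingSolver as ℕ-Solver using ()
open import Data.Parity using (Parity; 0ℙ; 1ℙ; _⁻¹)
open import Data.Parity.Properties using (⁻¹-selfInverse; ⁻¹-involutive; suc-homo-⁻¹)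
open import Data.Integer using (>-nonZero; ℤ; +_; -[1+_]; 0ℤ; 1ℤ; _+_; _-_; _*_; _<_; +<+; ∣_∣)
open import Data.Integer.Properties
  using ( +-injective; *-identityˡ; *-identityʳ; *-zeroʳ; *-comm; *-cancelˡ-≡; *-cancelˡ-<-nonNeg
        ; abs-*; i*j≢0; *-commutativeSemigroup)
open import Data.Integer.Tactic.RingSolver using (solve-∀; solve)
open import Relation.Nullary.Decidable using (yes; _→-dec_; from-yes)
open import Relation.Binary.PropositionalEquality
open ≡-Reasoning
open import Algebra.Properties.CommutativeSemigroup *-commutativeSemigroup using (interchange)

-- The positive integer solutions of x u z = x + u + z + 2.
data Solution : ℤ → ℤ → ℤ → Set where
  s125 : Solution (+ 1) (+ 2) (+ 5)
  s133 : Solution (+ 1) (+ 3) (+ 3)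
  s152 : Solution (+ 1) (+ 5) (+ 2)
  s215 : Solution (+ 2) (+ 1) (+ 5)
  s222 : Solution (+ 2) (+ 2) (+ 2)
  s251 : Solution (+ 2) (+ 5) (+ 1)
  s313 : Solution (+ 3) (+ 1) (+ 3)
  s331 : Solution (+ 3) (+ 3) (+ 1)
  s512 : Solution (+ 5) (+ 1) (+ 2)
  s521 : Solution (+ 5) (+ 2) (+ 1)

-- With x = p + 1, u = q + 1, z = r + 1 the equation becomes σ p q r = 4.
σ : ℕ → ℕ → ℕ → ℕ
σ p q r = p ℕ.* (q ℕ.+ r ℕ.+ q ℕ.* r) ℕ.+ q ℕ.* r

product≡sum⇒σ≡4 : ∀ p q r →
  suc p ℕ.* suc q ℕ.* suc r ≡ suc p ℕ.+ suc q ℕ.+ suc r ℕ.+ 2 → σ p q r ≡ 4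
product≡sum⇒σ≡4 p q r eq = ℕ.+-cancelˡ-≡ (p ℕ.+ q ℕ.+ r ℕ.+ 1) (σ p q r) 4 (begin
  p ℕ.+ q ℕ.+ r ℕ.+ 1 ℕ.+ (p ℕ.* (q ℕ.+ r ℕ.+ q ℕ.* r) ℕ.+ q ℕ.* r)
                                            ≡⟨ ℕ-Solver.solve (p ∷ q ∷ r ∷ []) ⟩
  suc p ℕ.* suc q ℕ.* suc r                 ≡⟨ eq ⟩
  suc p ℕ.+ suc q ℕ.+ suc r ℕ.+ 2           ≡⟨ ℕ-Solver.solve (p ∷ q ∷ r ∷ []) ⟩
  p ℕ.+ q ℕ.+ r ℕ.+ 1 ℕ.+ 4                 ∎)

σ-rotate : ∀ p q r → σ p q r ≡ σ q r p
σ-rotate p q r = begin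
  p ℕ.* (q ℕ.+ r ℕ.+ q ℕ.* r) ℕ.+ q ℕ.* r   ≡⟨ ℕ-Solver.solve (p ∷ q ∷ r ∷ []) ⟩
  q ℕ.* (r ℕ.+ p ℕ.+ r ℕ.* p) ℕ.+ r ℕ.* p   ∎

σ≡4⇒<5 : ∀ p q r → σ p q r ≡ 4 → p ℕ.< 5
σ≡4⇒<5 p zero    zero    eq with () ← trans (sym (ℕ.*-zeroʳ p)) (trans (sym (ℕ.+-identityʳ _)) eq)
σ≡4⇒<5 p (suc q) r       eq = s≤s (ℕ.≤-trans (ℕ.m≤m*n p _) (ℕ.≤-trans (ℕ.m≤m+n _ _) (ℕ.≤-reflexive eq)))
σ≡4⇒<5 p zero    (suc r) eq = s≤s (ℕ.≤-trans (ℕ.m≤m*n p _) (ℕ.≤-trans (ℕ.m≤m+n _ _) (ℕ.≤-reflexive eq)))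

lookupSolution : ∀ p q r → Maybe (Solution (+ suc p) (+ suc q) (+ suc r))
lookupSolution 0 1 4 = just s125
lookupSolution 0 2 2 = just s133
lookupSolution 0 4 1 = just s152
lookupSolution 1 0 4 = just s215
lookupSolution 1 1 1 = just s222
lookupSolution 1 4 0 = just s251
lookupSolution 2 0 2 = just s313
lookupSolution 2 2 0 = just s331
lookupSolution 4 0 1 = just s512
lookupSolution 4 1 0 = just s521
lookupSolution _ _ _ = nothing

lookupSolution-complete : ∀ {p} → p ℕ.< 5 → ∀ {q} → q ℕ.< 5 → ∀ {r} → r ℕ.< 5 →
  σ p q r ≡ 4 → Is-just (lookupSolution p q r)
lookupSolution-complete = from-yes
  (ℕ.allUpTo? (λ p → ℕ.allUpTo? (λ q → ℕ.allUpTo? (λ r →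
    (σ p q r ℕ.≟ 4) →-dec Maybe.dec (λ _ → yes tt) (lookupSolution p q r)) 5) 5) 5)

classify : ∀ {x u z} → 0ℤ < x → 0ℤ < u → 0ℤ < z →
  x * u * z ≡ x + u + z + + 2 → Solution x u z
classify {+ suc p} {+ suc q} {+ suc r} (+<+ _) (+<+ _) (+<+ _) eq =
  to-witness (lookupSolution-complete
    (σ≡4⇒<5 p q r σpqr≡4) (σ≡4⇒<5 q r p σqrp≡4) (σ≡4⇒<5 r p q σrpq≡4) σpqr≡4)
  where
  σpqr≡4 : σ p q r ≡ 4
  σpqr≡4 = product≡sum⇒σ≡4 p q r (+-injective eq)
  σqrp≡4 : σ q r p ≡ 4
  σqrp≡4 = trans (sym (σ-rotate p q r)) σpqr≡4
  σrpq≡4 : σ r p q ≡ 4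
  σrpq≡4 = trans (sym (σ-rotate q r p)) σqrp≡4

Solution-periodic : ∀ {x u z w} → Solution x u z → Solution u z w → w ≡ x
Solution-periodic s125 s251 = refl
Solution-periodic s133 s331 = refl
Solution-periodic s152 s521 = refl
Solution-periodic s215 s152 = refl
Solution-periodic s222 s222 = refl
Solution-periodic s251 s512 = refl
Solution-periodic s313 s133 = refl
Solution-periodic s331 s313 = refl
Solution-periodic s512 s125 = refl
Solution-periodic s521 s215 = refl

-- (m j , m (j + 3)) on row 2 of a frieze whose row 3 reads (x, u, z) at an even position j.
quiddityPair : ∀ {x u z} → Solution x u z → ℤ × ℤ
quiddityPair s125 = + 2 , + 2
quiddityPair s133 = + 1 , + 2
quiddityPair s152 = + 1 , + 1
quiddityPair s215 = + 3 , + 3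
quiddityPair s222 = + 1 , + 3
quiddityPair s251 = + 1 , + 1
quiddityPair s313 = + 2 , + 4
quiddityPair s331 = + 1 , + 2
quiddityPair s512 = + 3 , + 3
quiddityPair s521 = + 2 , + 2

quiddityPair-positive : ∀ {x u z} (s : Solution x u z) →
  0ℤ < proj₁ (quiddityPair s) × 0ℤ < proj₂ (quiddityPair s)
quiddityPair-positive s125 = +<+ z<s , +<+ z<s
quiddityPair-positive s133 = +<+ z<s , +<+ z<s
quiddityPair-positive s152 = +<+ z<s , +<+ z<s
quiddityPair-positive s215 = +<+ z<s , +<+ z<s
quiddityPair-positive s222 = +<+ z<s , +<+ z<s
quiddityPair-positive s251 = +<+ z<s , +<+ z<s
quiddityPair-positive s313 = +<+ z<s , +<+ z<s
quiddityPair-positive s331 = +<+ z<s , +<+ z<s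
quiddityPair-positive s512 = +<+ z<s , +<+ z<s
quiddityPair-positive s521 = +<+ z<s , +<+ z<s

quiddityPair-adjacent : ∀ {x u z w} (s : Solution x u z) (t : Solution u z w) →
  proj₁ (quiddityPair s) * proj₂ (quiddityPair t) ≡ x + 1ℤ ×
  proj₂ (quiddityPair s) * proj₁ (quiddityPair t) ≡ x + 1ℤ
quiddityPair-adjacent s125 s251 = refl , refl
quiddityPair-adjacent s133 s331 = refl , refl
quiddityPair-adjacent s152 s521 = refl , refl
quiddityPair-adjacent s215 s152 = refl , refl
quiddityPair-adjacent s222 s222 = refl , refl
quiddityPair-adjacent s251 s512 = refl , refl
quiddityPair-adjacent s313 s133 = refl , refl
quiddityPair-adjacent s331 s313 = refl , refl
quiddityPair-adjacent s512 s125 = refl , refl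
quiddityPair-adjacent s521 s215 = refl , refl

quiddityPair-opposite : ∀ {x u z} (s t : Solution x u z) →
  proj₁ (quiddityPair s) * proj₂ (quiddityPair t) ≡ z * x - 1ℤ
quiddityPair-opposite s125 s125 = refl
quiddityPair-opposite s133 s133 = refl
quiddityPair-opposite s152 s152 = refl
quiddityPair-opposite s215 s215 = refl
quiddityPair-opposite s222 s222 = refl
quiddityPair-opposite s251 s251 = refl
quiddityPair-opposite s313 s313 = refl
quiddityPair-opposite s331 s331 = refl
quiddityPair-opposite s512 s512 = refl
quiddityPair-opposite s521 s521 = refl

quiddity : ∀ {x u z} → Parity → Solution x u z → ℤ
quiddity 0ℙ s = proj₁ (quiddityPair s)
quiddity 1ℙ s = proj₂ (quiddityPair s)

quiddity-positive : ∀ {x u z} p (s : Solution x u z) → 0ℤ < quiddity p s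
quiddity-positive 0ℙ s = proj₁ (quiddityPair-positive s)
quiddity-positive 1ℙ s = proj₂ (quiddityPair-positive s)

quiddity-adjacent : ∀ {x u z w} p q (s : Solution x u z) (t : Solution u z w) →
  q ≡ p ⁻¹ → quiddity p s * quiddity q t ≡ x + 1ℤ
quiddity-adjacent 0ℙ _ s t refl = proj₁ (quiddityPair-adjacent s t)
quiddity-adjacent 1ℙ _ s t refl = proj₂ (quiddityPair-adjacent s t)

quiddity-opposite : ∀ {x u z x′ u′ z′} p q (s : Solution x u z) (t : Solution x′ u′ z′) →
  q ≡ p ⁻¹ → x′ ≡ x → u′ ≡ u → z′ ≡ z → quiddity p s * quiddity q t ≡ z * x - 1ℤ
quiddity-opposite 0ℙ _ s t refl refl refl refl = quiddityPair-opposite s t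
quiddity-opposite 1ℙ _ s t refl refl refl refl =
  trans (*-comm (quiddity 1ℙ s) (quiddity 0ℙ t)) (quiddityPair-opposite t s)

κ : ℤ → ℤ → ℤ → ℤ → ℤ
κ x u z c = x * u * z - x - z - 1ℤ - c

diamond⇒factor : ∀ {x u z c} →
  (x * u - 1ℤ) * (u * z - 1ℤ) ≡ (1ℤ + u) * (1ℤ + c) → u * κ x u z c ≡ c
diamond⇒factor {x} {u} {z} {c} eq = begin
  u * (x * u * z - x - z - 1ℤ - c)                        ≡⟨ solve (x ∷ u ∷ z ∷ c ∷ []) ⟩
  (x * u - 1ℤ) * (u * z - 1ℤ) - (1ℤ + u) * (1ℤ + c) + c   ≡⟨ cong (λ d → d - (1ℤ + u) * (1ℤ + c) + c) eq ⟩
  (1ℤ + u) * (1ℤ + c) - (1ℤ + u) * (1ℤ + c) + c           ≡⟨ solve (u ∷ c ∷ []) ⟩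
  c                                                       ∎

i>0∧i*j≡1⇒i≡1 : ∀ {i j} → 0ℤ < i → i * j ≡ 1ℤ → i ≡ 1ℤ
i>0∧i*j≡1⇒i≡1 {+ suc n} {j} _ eq =
  cong +_ (ℕ.m*n≡1⇒m≡1 (suc n) ∣ j ∣ (trans (sym (abs-* (+ suc n) j)) (cong ∣_∣ eq)))

i>0∧i*j>0⇒j>0 : ∀ {i j} → 0ℤ < i → 0ℤ < i * j → 0ℤ < j
i>0∧i*j>0⇒j>0 {+ zero}          (+<+ ())
i>0∧i*j>0⇒j>0 {i@(+ suc _)} {j} _ ij>0 =
  *-cancelˡ-<-nonNeg i (subst (_< i * j) (sym (*-zeroʳ i)) ij>0)

diamonds⇒triple-equation : ∀ x u z w {c₀ c₁} → 0ℤ < u → 0ℤ < z → 0ℤ < c₀ →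
  (x * u - 1ℤ) * (u * z - 1ℤ) ≡ (1ℤ + u) * (1ℤ + c₀) →
  (u * z - 1ℤ) * (z * w - 1ℤ) ≡ (1ℤ + z) * (1ℤ + c₁) →
  c₀ * c₁ ≡ u * z →
  x * u * z ≡ x + u + z + + 2
diamonds⇒triple-equation x u z w {c₀} {c₁} u>0 z>0 c₀>0 d₀ d₁ c₀c₁≡uz = begin
  x * u * z                  ≡⟨ solve (x ∷ u ∷ z ∷ c₀ ∷ []) ⟩
  (x * u * z - x - z - 1ℤ - c₀) + (x + z + 1ℤ + c₀)
                             ≡⟨ cong₂ (λ k c → k + (x + z + 1ℤ + c)) κ₀≡1 c₀≡u ⟩
  1ℤ + (x + z + 1ℤ + u)      ≡⟨ solve (x ∷ u ∷ z ∷ []) ⟩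
  x + u + z + + 2            ∎
  where
  κ₀ κ₁ : ℤ
  κ₀ = κ x u z c₀
  κ₁ = κ u z w c₁
  uκ₀≡c₀ : u * κ₀ ≡ c₀
  uκ₀≡c₀ = diamond⇒factor {x} {u} {z} d₀
  κ₀κ₁≡1 : κ₀ * κ₁ ≡ 1ℤ
  κ₀κ₁≡1 = *-cancelˡ-≡ (u * z) (κ₀ * κ₁) 1ℤ {{i*j≢0 u z {{>-nonZero u>0}} {{>-nonZero z>0}}}}
    (begin
    (u * z) * (κ₀ * κ₁)      ≡⟨ interchange u z κ₀ κ₁ ⟩
    (u * κ₀) * (z * κ₁)      ≡⟨ cong₂ _*_ uκ₀≡c₀ (diamond⇒factor {u} {z} {w} d₁) ⟩
    c₀ * c₁                  ≡⟨ c₀c₁≡uz ⟩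
    u * z                    ≡⟨ sym (*-identityʳ (u * z)) ⟩
    (u * z) * 1ℤ             ∎)
  κ₀≡1 : κ₀ ≡ 1ℤ
  κ₀≡1 = i>0∧i*j≡1⇒i≡1 (i>0∧i*j>0⇒j>0 u>0 (subst (0ℤ <_) (sym uκ₀≡c₀) c₀>0)) κ₀κ₁≡1
  c₀≡u : c₀ ≡ u
  c₀≡u = begin
    c₀        ≡⟨ sym uκ₀≡c₀ ⟩
    u * κ₀    ≡⟨ cong (u *_) κ₀≡1 ⟩
    u * 1ℤ    ≡⟨ *-identityʳ u ⟩
    u         ∎

parityℤ : ℤ → Parity
parityℤ (+ n)    = ℕ.parity n
parityℤ -[1+ n ] = ℕ.parity (suc n)

parity-suc : ∀ n → ℕ.parity (suc n) ≡ ℕ.parity n ⁻¹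
parity-suc n = sym (⁻¹-selfInverse (suc-homo-⁻¹ n))

parityℤ-+1 : ∀ j → parityℤ (j + 1ℤ) ≡ parityℤ j ⁻¹
parityℤ-+1 (+ n)          = trans (cong ℕ.parity (ℕ.+-comm n 1)) (parity-suc n)
parityℤ-+1 -[1+ zero ]    = refl
parityℤ-+1 -[1+ suc n ]   = parity-suc n

parityℤ-+3 : ∀ j → parityℤ (j + 1ℤ + 1ℤ + 1ℤ) ≡ parityℤ j ⁻¹
parityℤ-+3 j = begin
  parityℤ (j + 1ℤ + 1ℤ + 1ℤ)  ≡⟨ parityℤ-+1 (j + 1ℤ + 1ℤ) ⟩
  parityℤ (j + 1ℤ + 1ℤ) ⁻¹    ≡⟨ cong _⁻¹ (parityℤ-+1 (j + 1ℤ)) ⟩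
  parityℤ (j + 1ℤ) ⁻¹ ⁻¹      ≡⟨ ⁻¹-involutive (parityℤ (j + 1ℤ)) ⟩
  parityℤ (j + 1ℤ)            ≡⟨ parityℤ-+1 j ⟩
  parityℤ j ⁻¹                ∎

frieze₃ : (ℤ → ℤ) → (ℤ → ℤ) → (ℤ → ℤ) → Array
frieze₃ r₂ r₃ r₄ 0 _ = 0ℤ
frieze₃ r₂ r₃ r₄ 1 _ = 1ℤ
frieze₃ r₂ r₃ r₄ 2 j = r₂ j
frieze₃ r₂ r₃ r₄ 3 j = r₃ j
frieze₃ r₂ r₃ r₄ 4 j = r₄ j
frieze₃ r₂ r₃ r₄ 5 _ = 1ℤ
frieze₃ r₂ r₃ r₄ (suc (suc (suc (suc (suc (suc _)))))) _ = 0ℤ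

frieze₃-isArithFrieze : ∀ r₂ r₃ r₄ →
  (∀ j → 0ℤ < r₂ j) → (∀ j → 0ℤ < r₃ j) → (∀ j → 0ℤ < r₄ j) →
  (∀ j → r₂ j * r₂ (j + 1ℤ) - r₃ j ≡ 1ℤ) →
  (∀ j → r₃ j * r₃ (j + 1ℤ) - r₂ (j + 1ℤ) * r₄ j ≡ 1ℤ) →
  (∀ j → r₄ j * r₄ (j + 1ℤ) - r₃ (j + 1ℤ) ≡ 1ℤ) →
  IsArithFrieze 3 (frieze₃ r₂ r₃ r₄)
frieze₃-isArithFrieze r₂ r₃ r₄ r₂>0 r₃>0 r₄>0 u₂ u₃ u₄ = record
  { row0 = λ _ → refl
  ; row1 = λ _ → refl
  ; rowOnes = λ _ → refl
  ; rowZeros = λ _ → refl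
  ; unimodular = unimodular
  ; positive = positive
  }
  where
  unimodular : ∀ k j → k ℕ.≤ 4 →
    frieze₃ r₂ r₃ r₄ (suc k) j * frieze₃ r₂ r₃ r₄ (suc k) (j + 1ℤ)
      - frieze₃ r₂ r₃ r₄ k (j + 1ℤ) * frieze₃ r₂ r₃ r₄ (suc (suc k)) j ≡ 1ℤ
  unimodular 0 j _ = refl
  unimodular 1 j _ = trans (cong (r₂ j * r₂ (j + 1ℤ) -_) (*-identityˡ (r₃ j))) (u₂ j)
  unimodular 2 j _ = u₃ j
  unimodular 3 j _ = trans (cong (r₄ j * r₄ (j + 1ℤ) -_) (*-identityʳ (r₃ (j + 1ℤ)))) (u₄ j)
  unimodular 4 j _ = cong (1ℤ -_) (*-zeroʳ (r₄ (j + 1ℤ)))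
  unimodular (suc (suc (suc (suc (suc _))))) j (s≤s (s≤s (s≤s (s≤s ()))))

  positive : ∀ i j → 1 ℕ.≤ i → i ℕ.≤ 5 → 0ℤ < frieze₃ r₂ r₃ r₄ i j
  positive 1 j _ _ = +<+ z<s
  positive 2 j _ _ = r₂>0 j
  positive 3 j _ _ = r₃>0 j
  positive 4 j _ _ = r₄>0 j
  positive 5 j _ _ = +<+ z<s
  positive (suc (suc (suc (suc (suc (suc _)))))) j _ (s≤s (s≤s (s≤s (s≤s (s≤s ())))))

1+i-1≡i : ∀ i → 1ℤ + i - 1ℤ ≡ i
1+i-1≡i = solve-∀

i+1-1≡i : ∀ i → i + 1ℤ - 1ℤ ≡ i
i+1-1≡i = solve-∀

i+1-i≡1 : ∀ i → i + 1ℤ - i ≡ 1ℤ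
i+1-i≡1 = solve-∀

i-[i-1]≡1 : ∀ i → i - (i - 1ℤ) ≡ 1ℤ
i-[i-1]≡1 = solve-∀

module FromYFrieze {y : Array} (isY : IsArithYFrieze 3 y) where
  open IsArithYFrieze isY

  a c : ℤ → ℤ
  a = y 1
  c = y 3

  a>0 : ∀ j → 0ℤ < a j
  a>0 j = positive 1 j (s≤s z≤n) (s≤s z≤n)

  c>0 : ∀ j → 0ℤ < c j
  c>0 j = positive 3 j (s≤s z≤n) (s≤s (s≤s (s≤s z≤n)))

  1+second-row : ∀ j → 1ℤ + y 2 j ≡ a j * a (j + 1ℤ)
  1+second-row j = sym (begin
    a j * a (j + 1ℤ)                      ≡⟨ diamond 0 j (s≤s z≤n) ⟩
    (1ℤ + y 0 (j + 1ℤ)) * (1ℤ + y 2 j)    ≡⟨ cong (λ t → (1ℤ + t) * (1ℤ + y 2 j)) (row0 (j + 1ℤ)) ⟩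
    1ℤ * (1ℤ + y 2 j)                     ≡⟨ *-identityˡ (1ℤ + y 2 j) ⟩
    1ℤ + y 2 j                            ∎)

  second-row : ∀ j → y 2 j ≡ a j * a (j + 1ℤ) - 1ℤ
  second-row j = begin
    y 2 j                   ≡⟨ sym (1+i-1≡i (y 2 j)) ⟩
    1ℤ + y 2 j - 1ℤ         ≡⟨ cong (_- 1ℤ) (1+second-row j) ⟩
    a j * a (j + 1ℤ) - 1ℤ   ∎

  middle-diamond : ∀ j →
    (a j * a (j + 1ℤ) - 1ℤ) * (a (j + 1ℤ) * a (j + 1ℤ + 1ℤ) - 1ℤ) ≡ (1ℤ + a (j + 1ℤ)) * (1ℤ + c j)
  middle-diamond j = begin
    (a j * a (j + 1ℤ) - 1ℤ) * (a (j + 1ℤ) * a (j + 1ℤ + 1ℤ) - 1ℤ)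
                                 ≡⟨ sym (cong₂ _*_ (second-row j) (second-row (j + 1ℤ))) ⟩
    y 2 j * y 2 (j + 1ℤ)         ≡⟨ diamond 1 j (s≤s (s≤s z≤n)) ⟩
    (1ℤ + a (j + 1ℤ)) * (1ℤ + c j) ∎

  third-row : ∀ j → c j * c (j + 1ℤ) ≡ a (j + 1ℤ) * a (j + 1ℤ + 1ℤ)
  third-row j = begin
    c j * c (j + 1ℤ)                    ≡⟨ diamond 2 j (s≤s (s≤s (s≤s z≤n))) ⟩
    (1ℤ + y 2 (j + 1ℤ)) * (1ℤ + y 4 j)  ≡⟨ cong (λ t → (1ℤ + y 2 (j + 1ℤ)) * (1ℤ + t)) (rowLast j) ⟩
    (1ℤ + y 2 (j + 1ℤ)) * 1ℤ            ≡⟨ *-identityʳ (1ℤ + y 2 (j + 1ℤ)) ⟩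
    1ℤ + y 2 (j + 1ℤ)                   ≡⟨ 1+second-row (j + 1ℤ) ⟩
    a (j + 1ℤ) * a (j + 1ℤ + 1ℤ)        ∎

  triple : ∀ j → Solution (a j) (a (j + 1ℤ)) (a (j + 1ℤ + 1ℤ))
  triple j = classify (a>0 j) (a>0 (j + 1ℤ)) (a>0 (j + 1ℤ + 1ℤ))
    (diamonds⇒triple-equation (a j) (a (j + 1ℤ)) (a (j + 1ℤ + 1ℤ)) (a (j + 1ℤ + 1ℤ + 1ℤ))
      (a>0 (j + 1ℤ)) (a>0 (j + 1ℤ + 1ℤ)) (c>0 j)
      (middle-diamond j) (middle-diamond (j + 1ℤ)) (third-row j))

  a-periodic : ∀ j → a (j + 1ℤ + 1ℤ + 1ℤ) ≡ a j
  a-periodic j = Solution-periodic (triple j) (triple (j + 1ℤ))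

  m : ℤ → ℤ
  m j = quiddity (parityℤ j) (triple j)

  m-adjacent : ∀ j → m j * m (j + 1ℤ) ≡ a j + 1ℤ
  m-adjacent j = quiddity-adjacent _ _ (triple j) (triple (j + 1ℤ)) (parityℤ-+1 j)

  m-opposite : ∀ j → m j * m (j + 1ℤ + 1ℤ + 1ℤ) ≡ a (j + 1ℤ + 1ℤ) * a j - 1ℤ
  m-opposite j = quiddity-opposite _ _ (triple j) (triple (j + 1ℤ + 1ℤ + 1ℤ))
    (parityℤ-+3 j) (a-periodic j) (a-periodic (j + 1ℤ)) (a-periodic (j + 1ℤ + 1ℤ))

  m>0 : ∀ j → 0ℤ < m j
  m>0 j = quiddity-positive (parityℤ j) (triple j)

  -- Row 4 is row 2 moved by the glide reflection of width-3 friezes.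
  m⁺⁴ : ℤ → ℤ
  m⁺⁴ j = m (j + 1ℤ + 1ℤ + 1ℤ + 1ℤ)

  row₂-unimodular : ∀ j → m j * m (j + 1ℤ) - a j ≡ 1ℤ
  row₂-unimodular j = begin
    m j * m (j + 1ℤ) - a j   ≡⟨ cong (_- a j) (m-adjacent j) ⟩
    a j + 1ℤ - a j           ≡⟨ i+1-i≡1 (a j) ⟩
    1ℤ                       ∎

  row₃-unimodular : ∀ j → a j * a (j + 1ℤ) - m (j + 1ℤ) * m⁺⁴ j ≡ 1ℤ
  row₃-unimodular j = begin
    a j * a (j + 1ℤ) - m (j + 1ℤ) * m⁺⁴ j
      ≡⟨ cong (a j * a (j + 1ℤ) -_) (m-opposite (j + 1ℤ)) ⟩
    a j * a (j + 1ℤ) - (a (j + 1ℤ + 1ℤ + 1ℤ) * a (j + 1ℤ) - 1ℤ)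
      ≡⟨ cong (λ t → a j * a (j + 1ℤ) - (t * a (j + 1ℤ) - 1ℤ)) (a-periodic j) ⟩
    a j * a (j + 1ℤ) - (a j * a (j + 1ℤ) - 1ℤ)
      ≡⟨ i-[i-1]≡1 (a j * a (j + 1ℤ)) ⟩
    1ℤ ∎

  row₄-unimodular : ∀ j → m⁺⁴ j * m⁺⁴ (j + 1ℤ) - a (j + 1ℤ) ≡ 1ℤ
  row₄-unimodular j = begin
    m⁺⁴ j * m⁺⁴ (j + 1ℤ) - a (j + 1ℤ)
      ≡⟨ cong (_- a (j + 1ℤ)) (m-adjacent (j + 1ℤ + 1ℤ + 1ℤ + 1ℤ)) ⟩
    a (j + 1ℤ + 1ℤ + 1ℤ + 1ℤ) + 1ℤ - a (j + 1ℤ)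
      ≡⟨ cong (λ t → t + 1ℤ - a (j + 1ℤ)) (a-periodic (j + 1ℤ)) ⟩
    a (j + 1ℤ) + 1ℤ - a (j + 1ℤ)
      ≡⟨ i+1-i≡1 (a (j + 1ℤ)) ⟩
    1ℤ ∎

  frieze : Frieze 3
  frieze = frieze₃ m a m⁺⁴ , frieze₃-isArithFrieze m a m⁺⁴ m>0 a>0 (λ j → m>0 (j + 1ℤ + 1ℤ + 1ℤ + 1ℤ))
    row₂-unimodular row₃-unimodular row₄-unimodular

  frieze-maps-to-y : ∀ j → y 1 j ≡ pFirstRow (proj₁ frieze) j
  frieze-maps-to-y j = begin
    a j                    ≡⟨ sym (i+1-1≡i (a j)) ⟩
    a j + 1ℤ - 1ℤ          ≡⟨ cong (_- 1ℤ) (sym (m-adjacent j)) ⟩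
    m j * m (j + 1ℤ) - 1ℤ  ∎

corollary2p5 : ∀ (Y : YFrieze 3) → ∃ λ (F : Frieze 3) → pMapsTo F Y
corollary2p5 (y , isY) = frieze , frieze-maps-to-y
  where open FromYFrieze isY
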